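{- For every even integer $t>3$, the $3$-uniform wheel $W^{(3)}_t$ does not have the following property $(\clubsuit)$: there exist an ordering $(u_1,\dots,u_t)$ of $V(W^{(3)}_t)$ and a $2$-coloring $\chi:\partial W^{(3)}_t\to\{\mathrm{red},\mathrm{blue}\}$ such that every edge $\{u_i,u_j,u_k\}$ with $i<j<k$ satisfies $(\chi(u_i,u_j),\chi(u_j,u_k),\chi(u_i,u_k))\in\{(\mathrm{red},\mathrm{red},\mathrm{blue}),(\mathrm{blue},\mathrm{blue},\mathrm{red})\}$.
   Context: $W^{(3)}_t$ is the $3$-graph on vertices $v_0,v_1,\dots,v_{t-1}$ with edges $\{v_0,v_i,v_{i+1}\}$ for $i=1,\dots,t-1$, where $v_t:=v_1$ (rim indices cyclic). The shadow $\partial F$ of a $3$-graph $F$ is the set of pairs contained in some edge of $F$. -}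

module Defs where

open import Data.Nat using (ℕ; zero; suc; _≟_) renaming (_<_ to _<ℕ_; _≤_ to _≤ℕ_)
open import Data.Nat.Properties using ()
open import Data.Fin using (Fin; toℕ; _<_)
open import Data.Bool using (Bool; true; false)
open import Data.Product using (Σ; ∃; ∃-syntax; _×_; _,_)
open import Data.Sum using (_⊎_)
open import Data.Nat.Divisibility using (_∣_)
open import Relation.Binary.PropositionalEquality using (_≡_)
open import Relation.Nullary using (¬_; yes; no)
open import Function.Bundles using (_↔_; Inverse)

data Colour : Set where
  red blue : Colour

-- Rim successor on indices 1..t-1 (as natural numbers): i ↦ i+1, with t ↦ 1,
-- i.e. next (t-1) = 1.
rimNext : ℕ → ℕ → ℕ
rimNext t i with suc i ≟ t
... | yes _ = 1
... | no _  = suc i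

SameTriple : (a b c x y z : ℕ) → Set
SameTriple a b c x y z =
    (a ≡ x × b ≡ y × c ≡ z) ⊎ (a ≡ x × b ≡ z × c ≡ y)
  ⊎ (a ≡ y × b ≡ x × c ≡ z) ⊎ (a ≡ y × b ≡ z × c ≡ x)
  ⊎ (a ≡ z × b ≡ x × c ≡ y) ⊎ (a ≡ z × b ≡ y × c ≡ x)

-- Vertices of W^(3)_t are Fin t, v_i = i; v_0 is the centre.
-- {a,b,c} is an edge iff it equals {v_0, v_i, v_{i+1}} for some 1 ≤ i ≤ t-1
-- (rim indices cyclic, v_t := v_1).
WheelEdge : (t : ℕ) → Fin t → Fin t → Fin t → Set
WheelEdge t a b c =
  ∃[ i ] (1 ≤ℕ i × i <ℕ t ×
          SameTriple (toℕ a) (toℕ b) (toℕ c) 0 i (rimNext t i))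

InShadow : (t : ℕ) → Fin t → Fin t → Set
InShadow t x y = ¬ (x ≡ y) × ∃[ z ] WheelEdge t x y z

-- A 2-colouring of the shadow: a colour for every ordered shadow pair,
-- independent of the order of the two vertices (so it colours unordered pairs).
record ShadowColouring (t : ℕ) : Set where
  field
    χ    : (x y : Fin t) → InShadow t x y → Colour
    symm : (x y : Fin t) (p : InShadow t x y) (q : InShadow t y x) → χ x y p ≡ χ y x q

-- An ordering (u_1,…,u_t) of V is a bijection u : Fin t ↔ Fin t (position ↦ vertex).
Clubsuit : (t : ℕ) → Set
Clubsuit t =
  Σ (Fin t ↔ Fin t) λ ord →
  Σ (ShadowColouring t) λ C →
    let u = Inverse.to ord
        χ = ShadowColouring.χ C
    in (i j k : Fin t) → i < j → j < k →
       (e : WheelEdge t (u i) (u j) (u k)) →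
       (pij : InShadow t (u i) (u j)) (pjk : InShadow t (u j) (u k)) (pik : InShadow t (u i) (u k)) →
       (χ _ _ pij ≡ red × χ _ _ pjk ≡ red × χ _ _ pik ≡ blue)
       ⊎ (χ _ _ pij ≡ blue × χ _ _ pjk ≡ blue × χ _ _ pik ≡ red)

-- Read the colour of a shadow pair in the direction of the ordering, flipping it when the
-- pair is traversed backwards. Then (♣) forces the three pairs of every edge, read cyclically
-- around the triangle, to get the same oriented colour. On an
-- edge {v₀, vᵢ, vᵢ₊₁} this makes the oriented colours of the spokes v₀vᵢ and v₀vᵢ₊₁ differ,
-- so the spoke colours alternate around the rim; but for even t the rim is an odd cycle.
module Submission where

open import Defs
open import Data.Nat using (ℕ; _>_)
open import Data.Nat.Divisibility using (_∣_)
open import Relation.Nullary using (¬_)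

open import Data.Nat.Base using (zero; suc; _+_; _%_; _/_; NonZero; z≤n; s≤s)
import Data.Nat.Properties as ℕ
open import Data.Nat.DivMod using (m≡m%n+[m/n]*n; [m+n]%n≡m%n; [m+kn]%n≡m%n; n%n≡0; m%n<n; m<n⇒m%n≡m)
open import Data.Nat.Divisibility using (divides)
open import Data.Fin.Base using (Fin; zero; suc; toℕ; fromℕ<; _<_)
open import Data.Fin.Properties using (_<?_; <-cmp; <-trans; toℕ-fromℕ<; fromℕ<-cong)
open import Data.Product using (∃; _×_; _,_; proj₁; proj₂)
open import Data.Sum using (_⊎_; inj₁; inj₂)
open import Relation.Nullary using (Dec; yes; no; contradiction)
open import Relation.Binary.Definitions using (tri<; tri≈; tri>)
open import Relation.Binary.PropositionalEquality
open import Function.Base using (_∘_)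
open import Function.Bundles using (Inverse)

flip : Colour → Colour
flip red  = blue
flip blue = red

flip-involutive : ∀ c → flip (flip c) ≡ c
flip-involutive red  = refl
flip-involutive blue = refl

c≢flip-c : ∀ c → c ≢ flip c
c≢flip-c red  ()
c≢flip-c blue ()

orient : ∀ {A : Set} → Dec A → Colour → Colour
orient (yes _) c = c
orient (no _)  c = flip c

ClubsuitPattern : Colour → Colour → Colour → Set
ClubsuitPattern X Y Z = (X ≡ red × Y ≡ red × Z ≡ blue) ⊎ (X ≡ blue × Y ≡ blue × Z ≡ red)

clubsuitPattern⇒ : ∀ {X Y Z} → ClubsuitPattern X Y Z → X ≡ Y × Y ≡ flip Z
clubsuitPattern⇒ (inj₁ (refl , refl , refl)) = refl , refl
clubsuitPattern⇒ (inj₂ (refl , refl , refl)) = refl , refl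

alternating⇒even-period : (g : ℕ → Colour) → (∀ k → g k ≡ flip (g (suc k))) →
                          ∀ j → g 0 ≡ g (j + j)
alternating⇒even-period g alt zero    = refl
alternating⇒even-period g alt (suc j) = begin
  g 0                          ≡⟨ alternating⇒even-period g alt j ⟩
  g (j + j)                    ≡⟨ alt (j + j) ⟩
  flip (g (suc (j + j)))       ≡⟨ cong flip (alt (suc (j + j))) ⟩
  flip (flip (g (2 + (j + j)))) ≡⟨ flip-involutive _ ⟩
  g (2 + (j + j))              ≡⟨ cong (λ n → g (suc n)) (ℕ.+-suc j j) ⟨
  g (suc j + suc j)            ∎
  where open ≡-Reasoning

alternating⇒¬odd-period : (g : ℕ → Colour) → (∀ k → g k ≡ flip (g (suc k))) →
                          ∀ j → g 0 ≢ g (suc (j + j))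
alternating⇒¬odd-period g alt j g0≡godd =
  c≢flip-c (g 0) (trans (alternating⇒even-period g alt j)
                        (trans (alt (j + j)) (cong flip (sym g0≡godd))))

module _ {a b c x y z : ℕ} where

  SameTriple-swap₁₂ : SameTriple a b c x y z → SameTriple b a c x y z
  SameTriple-swap₁₂ (inj₁ (refl , refl , refl))                               = inj₂ (inj₂ (inj₁ (refl , refl , refl)))
  SameTriple-swap₁₂ (inj₂ (inj₁ (refl , refl , refl)))                        = inj₂ (inj₂ (inj₂ (inj₂ (inj₁ (refl , refl , refl)))))
  SameTriple-swap₁₂ (inj₂ (inj₂ (inj₁ (refl , refl , refl))))                 = inj₁ (refl , refl , refl)
  SameTriple-swap₁₂ (inj₂ (inj₂ (inj₂ (inj₁ (refl , refl , refl)))))          = inj₂ (inj₂ (inj₂ (inj₂ (inj₂ (refl , refl , refl)))))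
  SameTriple-swap₁₂ (inj₂ (inj₂ (inj₂ (inj₂ (inj₁ (refl , refl , refl)))))) = inj₂ (inj₁ (refl , refl , refl))
  SameTriple-swap₁₂ (inj₂ (inj₂ (inj₂ (inj₂ (inj₂ (refl , refl , refl)))))) = inj₂ (inj₂ (inj₂ (inj₁ (refl , refl , refl))))

  SameTriple-swap₂₃ : SameTriple a b c x y z → SameTriple a c b x y z
  SameTriple-swap₂₃ (inj₁ (refl , refl , refl))                               = inj₂ (inj₁ (refl , refl , refl))
  SameTriple-swap₂₃ (inj₂ (inj₁ (refl , refl , refl)))                        = inj₁ (refl , refl , refl)
  SameTriple-swap₂₃ (inj₂ (inj₂ (inj₁ (refl , refl , refl))))                 = inj₂ (inj₂ (inj₂ (inj₁ (refl , refl , refl))))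
  SameTriple-swap₂₃ (inj₂ (inj₂ (inj₂ (inj₁ (refl , refl , refl)))))          = inj₂ (inj₂ (inj₁ (refl , refl , refl)))
  SameTriple-swap₂₃ (inj₂ (inj₂ (inj₂ (inj₂ (inj₁ (refl , refl , refl)))))) = inj₂ (inj₂ (inj₂ (inj₂ (inj₂ (refl , refl , refl)))))
  SameTriple-swap₂₃ (inj₂ (inj₂ (inj₂ (inj₂ (inj₂ (refl , refl , refl)))))) = inj₂ (inj₂ (inj₂ (inj₂ (inj₁ (refl , refl , refl)))))

  SameTriple-distinct : x ≢ y → y ≢ z → x ≢ z → SameTriple a b c x y z → a ≢ b
  SameTriple-distinct x≢y y≢z x≢z (inj₁ (refl , refl , refl))                               = x≢y
  SameTriple-distinct x≢y y≢z x≢z (inj₂ (inj₁ (refl , refl , refl)))                        = x≢z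
  SameTriple-distinct x≢y y≢z x≢z (inj₂ (inj₂ (inj₁ (refl , refl , refl))))                 = ≢-sym x≢y
  SameTriple-distinct x≢y y≢z x≢z (inj₂ (inj₂ (inj₂ (inj₁ (refl , refl , refl)))))          = y≢z
  SameTriple-distinct x≢y y≢z x≢z (inj₂ (inj₂ (inj₂ (inj₂ (inj₁ (refl , refl , refl)))))) = ≢-sym x≢z
  SameTriple-distinct x≢y y≢z x≢z (inj₂ (inj₂ (inj₂ (inj₂ (inj₂ (refl , refl , refl)))))) = ≢-sym y≢z

rimNext-wrap : ∀ {t i} → suc i ≡ t → rimNext t i ≡ 1
rimNext-wrap {t} {i} 1+i≡t with suc i ℕ.≟ t
... | yes _     = refl
... | no 1+i≢t = contradiction 1+i≡t 1+i≢t

rimNext-step : ∀ {t i} → suc i ≢ t → rimNext t i ≡ suc i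
rimNext-step {t} {i} 1+i≢t with suc i ℕ.≟ t
... | yes 1+i≡t = contradiction 1+i≡t 1+i≢t
... | no _      = refl

0≢rimNext : ∀ t i → 0 ≢ rimNext t i
0≢rimNext t i with suc i ℕ.≟ t
... | yes _ = λ ()
... | no _  = λ ()

i≢rimNext : ∀ {t} i → t ≢ 2 → i ≢ rimNext t i
i≢rimNext {t} i t≢2 with suc i ℕ.≟ t
... | yes 1+i≡t = λ { refl → t≢2 (sym 1+i≡t) }
... | no _      = ≢-sym ℕ.1+n≢n

module _ {t : ℕ} where

  WheelEdge-swap₁₂ : ∀ {a b c : Fin t} → WheelEdge t a b c → WheelEdge t b a c
  WheelEdge-swap₁₂ (i , 1≤i , i<t , same) = i , 1≤i , i<t , SameTriple-swap₁₂ same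

  WheelEdge-swap₂₃ : ∀ {a b c : Fin t} → WheelEdge t a b c → WheelEdge t a c b
  WheelEdge-swap₂₃ (i , 1≤i , i<t , same) = i , 1≤i , i<t , SameTriple-swap₂₃ same

  WheelEdge-rotate : ∀ {a b c : Fin t} → WheelEdge t a b c → WheelEdge t b c a
  WheelEdge-rotate e = WheelEdge-swap₂₃ (WheelEdge-swap₁₂ e)

  WheelEdge-distinct : ∀ {a b c : Fin t} → t ≢ 2 → WheelEdge t a b c → a ≢ b
  WheelEdge-distinct t≢2 (i , s≤s z≤n , _ , same) a≡b =
    SameTriple-distinct (λ ()) (i≢rimNext i t≢2) (0≢rimNext t i) same (cong toℕ a≡b)

  WheelEdge⇒InShadow : ∀ {a b c : Fin t} → t ≢ 2 → WheelEdge t a b c → InShadow t a b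
  WheelEdge⇒InShadow {c = c} t≢2 e = WheelEdge-distinct t≢2 e , c , e

InShadow-sym : ∀ {t} {x y : Fin t} → InShadow t x y → InShadow t y x
InShadow-sym (x≢y , z , e) = ≢-sym x≢y , z , WheelEdge-swap₁₂ e

module Clubsuit-consequences {t : ℕ} (club : Clubsuit t) where

  private
    ord = proj₁ club
    C   = proj₁ (proj₂ club)
    open ShadowColouring C

  vertexAt : Fin t → Fin t
  vertexAt = Inverse.to ord

  position : Fin t → Fin t
  position = Inverse.from ord

  position-injective : ∀ {x y} → position x ≡ position y → x ≡ y
  position-injective {x} {y} eq = begin
    x                     ≡⟨ Inverse.strictlyInverseˡ ord x ⟨
    vertexAt (position x) ≡⟨ cong vertexAt eq ⟩
    vertexAt (position y) ≡⟨ Inverse.strictlyInverseˡ ord y ⟩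
    y                     ∎
    where open ≡-Reasoning

  χ-irrelevant : ∀ {x y} (p q : InShadow t x y) → χ x y p ≡ χ x y q
  χ-irrelevant {x} {y} p q = trans (symm x y p (InShadow-sym p)) (symm y x (InShadow-sym p) q)

  σ : (x y : Fin t) → InShadow t x y → Colour
  σ x y p = orient (position x <? position y) (χ x y p)

  σ-forward : ∀ {x y} (p : InShadow t x y) → position x < position y → σ x y p ≡ χ x y p
  σ-forward {x} {y} p x<y with position x <? position y
  ... | yes _   = refl
  ... | no x≮y = contradiction x<y x≮y

  σ-backward : ∀ {x y} (p : InShadow t x y) → position y < position x → σ x y p ≡ flip (χ x y p)
  σ-backward {x} {y} p y<x with position x <? position y
  ... | yes x<y = contradiction x<y (ℕ.<-asym y<x)
  ... | no _    = refl

  σ-cong : ∀ {x x′ y y′} → x ≡ x′ → y ≡ y′ →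
           (p : InShadow t x y) (q : InShadow t x′ y′) → σ x y p ≡ σ x′ y′ q
  σ-cong {x} {y = y} refl refl p q = cong (orient (position x <? position y)) (χ-irrelevant p q)

  σ-antisym : ∀ {x y} (p : InShadow t x y) (q : InShadow t y x) → σ y x q ≡ flip (σ x y p)
  σ-antisym {x} {y} p q with <-cmp (position x) (position y)
  ... | tri< x<y _ _ = begin
    σ y x q        ≡⟨ σ-backward q x<y ⟩
    flip (χ y x q) ≡⟨ cong flip (symm y x q p) ⟩
    flip (χ x y p) ≡⟨ cong flip (σ-forward p x<y) ⟨
    flip (σ x y p) ∎
    where open ≡-Reasoning
  ... | tri≈ _ x≈y _ = contradiction (position-injective x≈y) (proj₁ p)
  ... | tri> _ _ y<x = begin
    σ y x q               ≡⟨ σ-forward q y<x ⟩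
    χ y x q               ≡⟨ symm y x q p ⟩
    χ x y p               ≡⟨ flip-involutive _ ⟨
    flip (flip (χ x y p)) ≡⟨ cong flip (σ-backward p y<x) ⟨
    flip (σ x y p)        ∎
    where open ≡-Reasoning

  ClubsuitAt : Fin t → Fin t → Fin t → Set
  ClubsuitAt a b c = WheelEdge t a b c →
    (p : InShadow t a b) (q : InShadow t b c) (r : InShadow t a c) →
    ClubsuitPattern (χ a b p) (χ b c q) (χ a c r)

  clubsuitAt : ∀ {a b c} → position a < position b → position b < position c → ClubsuitAt a b c
  clubsuitAt {a} {b} {c} a<b b<c =
    transport (Inverse.strictlyInverseˡ ord a) (Inverse.strictlyInverseˡ ord b)
              (Inverse.strictlyInverseˡ ord c) (proj₂ (proj₂ club) _ _ _ a<b b<c)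
    where
    transport : ∀ {a b c a′ b′ c′} → a ≡ a′ → b ≡ b′ → c ≡ c′ → ClubsuitAt a b c → ClubsuitAt a′ b′ c′
    transport refl refl refl h = h

  Coherent : Fin t → Fin t → Fin t → Set
  Coherent a b c = (p : InShadow t a b) (q : InShadow t b c) (r : InShadow t c a) →
                   σ a b p ≡ σ b c q × σ b c q ≡ σ c a r

  Coherent-rotate : ∀ {a b c} → Coherent a b c → Coherent b c a
  Coherent-rotate h p q r = let ab≡bc , bc≡ca = h r p q in bc≡ca , sym (trans ab≡bc bc≡ca)

  Coherent-reverse : ∀ {a b c} → Coherent a b c → Coherent c b a
  Coherent-reverse h p q r =
    let p′ = InShadow-sym p; q′ = InShadow-sym q; r′ = InShadow-sym r
        ab≡bc , bc≡ca = h q′ p′ r′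
    in trans (σ-antisym p′ p) (trans (cong flip (sym ab≡bc)) (sym (σ-antisym q′ q)))
     , trans (σ-antisym q′ q) (trans (cong flip (trans ab≡bc bc≡ca)) (sym (σ-antisym r′ r)))

  sorted-coherent : ∀ {a b c} → position a < position b → position b < position c →
                    WheelEdge t a b c → Coherent a b c
  sorted-coherent {a} {b} {c} a<b b<c e p q r =
    trans (σ-forward p a<b) (trans ab≡bc (sym (σ-forward q b<c))) , (begin
      σ b c q         ≡⟨ σ-forward q b<c ⟩
      χ b c q         ≡⟨ bc≡flip-ac ⟩
      flip (χ a c r′) ≡⟨ cong flip (symm a c r′ r) ⟩
      flip (χ c a r)  ≡⟨ σ-backward r (<-trans a<b b<c) ⟨
      σ c a r         ∎)
    where
    open ≡-Reasoning
    r′ = InShadow-sym r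
    ab≡bc      = proj₁ (clubsuitPattern⇒ (clubsuitAt a<b b<c e p q r′))
    bc≡flip-ac = proj₂ (clubsuitPattern⇒ (clubsuitAt a<b b<c e p q r′))

  coherent : ∀ {a b c} → WheelEdge t a b c → Coherent a b c
  coherent {a} {b} {c} e p q r
    with <-cmp (position a) (position b) | <-cmp (position b) (position c) | <-cmp (position a) (position c)
  ... | tri≈ _ a≈b _ | _ | _ = contradiction (position-injective a≈b) (proj₁ p)
  ... | _ | tri≈ _ b≈c _ | _ = contradiction (position-injective b≈c) (proj₁ q)
  ... | _ | _ | tri≈ _ a≈c _ = contradiction (sym (position-injective a≈c)) (proj₁ r)
  ... | tri< a<b _ _ | tri< b<c _ _ | _ =
    sorted-coherent a<b b<c e p q r
  ... | tri> _ _ b<a | tri> _ _ c<b | _ =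
    Coherent-reverse (sorted-coherent c<b b<a (WheelEdge-swap₁₂ (WheelEdge-rotate e))) p q r
  ... | tri< a<b _ _ | tri> _ _ c<b | tri< a<c _ _ =
    Coherent-rotate (Coherent-rotate (Coherent-reverse (sorted-coherent a<c c<b (WheelEdge-swap₂₃ e)))) p q r
  ... | tri< a<b _ _ | tri> _ _ c<b | tri> _ _ c<a =
    Coherent-rotate (sorted-coherent c<a a<b (WheelEdge-rotate (WheelEdge-rotate e))) p q r
  ... | tri> _ _ b<a | tri< b<c _ _ | tri< a<c _ _ =
    Coherent-rotate (Coherent-reverse (sorted-coherent b<a a<c (WheelEdge-swap₁₂ e))) p q r
  ... | tri> _ _ b<a | tri< b<c _ _ | tri> _ _ c<a =
    Coherent-rotate (Coherent-rotate (sorted-coherent b<c c<a (WheelEdge-rotate e))) p q r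

  spokes-alternate : t ≢ 2 → ∀ {c a b} → WheelEdge t c a b →
                     (p : InShadow t c a) (q : InShadow t c b) → σ c a p ≡ flip (σ c b q)
  spokes-alternate t≢2 e p q =
    let rim  = WheelEdge⇒InShadow t≢2 (WheelEdge-rotate e)
        back = WheelEdge⇒InShadow t≢2 (WheelEdge-rotate (WheelEdge-rotate e))
        ca≡ab , ab≡bc = coherent e p rim back
    in trans ca≡ab (trans ab≡bc (σ-antisym q back))

module _ (m : ℕ) .{{_ : NonZero m}} where

  rimVertex : ℕ → Fin (suc m)
  rimVertex k = suc (fromℕ< (m%n<n k m))

  toℕ-rimVertex : ∀ k → toℕ (rimVertex k) ≡ suc (k % m)
  toℕ-rimVertex k = cong suc (toℕ-fromℕ< (m%n<n k m))

  rimVertex-periodic : rimVertex m ≡ rimVertex 0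
  rimVertex-periodic = cong suc (fromℕ<-cong _ _ ([m+n]%n≡m%n 0 m) _ _)

  1+k%m≡1+[k%m]%m : ∀ k → suc k % m ≡ suc (k % m) % m
  1+k%m≡1+[k%m]%m k = trans (cong (λ n → suc n % m) (m≡m%n+[m/n]*n k m))
                            ([m+kn]%n≡m%n (suc (k % m)) (k / m) m)

  rimNext-rimVertex : ∀ k → rimNext (suc m) (suc (k % m)) ≡ suc (suc k % m)
  rimNext-rimVertex k with suc (k % m) ℕ.≟ m
  ... | yes 1+k%m≡m = begin
    rimNext (suc m) (suc (k % m)) ≡⟨ rimNext-wrap (cong suc 1+k%m≡m) ⟩
    1                             ≡⟨ cong suc (n%n≡0 m) ⟨
    suc (m % m)                   ≡⟨ cong (λ n → suc (n % m)) 1+k%m≡m ⟨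
    suc (suc (k % m) % m)         ≡⟨ cong suc (1+k%m≡1+[k%m]%m k) ⟨
    suc (suc k % m)               ∎
    where open ≡-Reasoning
  ... | no 1+k%m≢m = begin
    rimNext (suc m) (suc (k % m)) ≡⟨ rimNext-step (1+k%m≢m ∘ ℕ.suc-injective) ⟩
    suc (suc (k % m))             ≡⟨ cong suc (m<n⇒m%n≡m (ℕ.≤∧≢⇒< (m%n<n k m) 1+k%m≢m)) ⟨
    suc (suc (k % m) % m)         ≡⟨ cong suc (1+k%m≡1+[k%m]%m k) ⟨
    suc (suc k % m)               ∎
    where open ≡-Reasoning

  rimEdge : ∀ k → WheelEdge (suc m) zero (rimVertex k) (rimVertex (suc k))
  rimEdge k = suc (k % m) , s≤s z≤n , s≤s (m%n<n k m) ,
              inj₁ (refl , toℕ-rimVertex k ,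
                    trans (toℕ-rimVertex (suc k)) (sym (rimNext-rimVertex k)))

¬Clubsuit-even : ∀ j → ¬ Clubsuit (suc (suc (suc j + suc j)))
¬Clubsuit-even j club =
  alternating⇒¬odd-period spokeColour alternates (suc j)
    (σ-cong refl (sym (rimVertex-periodic m)) (spoke 0) (spoke m))
  where
  open Clubsuit-consequences club
  m = suc (suc j + suc j)
  t≢2 : suc m ≢ 2
  t≢2 ()
  spoke : ∀ k → InShadow (suc m) zero (rimVertex m k)
  spoke k = WheelEdge⇒InShadow t≢2 (rimEdge m k)
  spokeColour : ℕ → Colour
  spokeColour k = σ zero (rimVertex m k) (spoke k)
  alternates : ∀ k → spokeColour k ≡ flip (spokeColour (suc k))
  alternates k = spokes-alternate t≢2 (rimEdge m k) (spoke k) (spoke (suc k))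

even>3⇒4+2j : ∀ {t} → 2 ∣ t → t > 3 → ∃ λ j → t ≡ suc (suc (suc j + suc j))
even>3⇒4+2j (divides 0 refl) ()
even>3⇒4+2j (divides 1 refl) (s≤s (s≤s ()))
even>3⇒4+2j (divides (suc (suc j)) refl) _ =
  j , cong (λ n → suc (suc n)) (trans (ℕ.*-comm (suc j) 2) (cong (suc j +_) (ℕ.+-identityʳ (suc j))))

lemma5p1 : (t : ℕ) → 2 ∣ t → t > 3 → ¬ Clubsuit t
lemma5p1 t 2∣t t>3 with even>3⇒4+2j 2∣t t>3
... | j , refl = ¬Clubsuit-even j
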